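{- Let $f(t)$ be a delta series with complex coefficients, let $\bar f(t)$ be its compositional inverse, write $e^{\bar{f}(t)}=\sum_{n=0}^{\infty}p_{n}\frac{t^{n}}{n!}$ (so $p_1=\bar f'(0)\neq0$), and let $\alpha\in\mathbb{C}$. For every integer $n \ge 0$, \[ B_{n,\bar{f}(t)}^{(\alpha)}=\sum_{k=0}^{n}(-\alpha)_{k}\,p_{1}^{ -\alpha-k}\,B_{n,k}\Big(\frac{p_{2}}{2},\frac{p_{3}}{3},\dots,\frac{p_{n-k+2}}{n-k+2}\Big). \]
   Context: All series are formal power series in $t$ over $\mathbb{C}$. A delta series is a formal power series $f(t)$ with $f(0)=0$, $f'(0)\neq0$; its compositional inverse $\bar f(t)$ is again a delta series. Fix a value of $p_1^{ -\alpha}$ and set $p_1^{ -\alpha-k}=p_1^{ -\alpha}p_1^{ -k}$. Writing $\frac{e^{\bar f(t)}-1}{t}=p_1(1+u(t))$ with $u(0)=0$, the power $\big(\frac{t}{e^{\bar f(t)}-1}\big)^{\alpha}$ is defined as $p_1^{ -\alpha}\sum_{k\ge0}\binom{ -\alpha}{k}u(t)^k$. The Bernoulli numbers of order $\alpha$ associated with $\bar f$ are defined by $\big(\frac{t}{e^{\bar f(t)}-1}\big)^{\alpha}=\sum_{n\ge0}B_{n,\bar f(t)}^{(\alpha)}\frac{t^n}{n!}$ (i.e. the value at $x=0$ of the polynomials defined by $\big(\frac{t}{e^{\bar f(t)}-1}\big)^{\alpha}e^{x\bar f(t)}=\sum_n B_{n,\bar f(t)}^{(\alpha)}(x)\frac{t^n}{n!}$).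 $(x)_0=1$, $(x)_k=x(x-1)\cdots(x-k+1)$ is the falling factorial. The partial Bell polynomials $B_{n,k}$ are defined by $\frac{1}{k!}\big(\sum_{m\ge1}x_m\frac{t^m}{m!}\big)^k=\sum_{n\ge k}B_{n,k}(x_1,\dots,x_{n-k+1})\frac{t^n}{n!}$. -}

module Defs where

open import Level using (Level; _⊔_) renaming (suc to lsuc)
open import Data.Nat as ℕ using (ℕ; zero; suc; _∸_)
open import Data.Product using (_×_)
open import Relation.Nullary using (¬_)
open import Algebra.Bundles using (CommutativeRing)

natR : ∀ {c ℓ} (R : CommutativeRing c ℓ) → ℕ → CommutativeRing.Carrier R
natR R zero    = CommutativeRing.0# R
natR R (suc n) = CommutativeRing._+_ R (CommutativeRing.1# R) (natR R n)

-- The value of x ⁻¹ for x ≈ 0 is irrelevant.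
record CharZeroField (c ℓ : Level) : Set (lsuc (c ⊔ ℓ)) where
  field
    cring : CommutativeRing c ℓ
  open CommutativeRing cring public
  field
    _⁻¹        : Carrier → Carrier
    ⁻¹-inverse : ∀ x → ¬ (x ≈ 0#) → (x * (x ⁻¹)) ≈ 1#
    char0      : ∀ n → ¬ (natR cring (suc n) ≈ 0#)

module FPS {c ℓ} (F : CharZeroField c ℓ) where
  open CharZeroField F using (Carrier; _≈_; _+_; _*_; -_; _-_; 0#; 1#; _⁻¹; cring)

  -- formal power series: a n is the coefficient of t^n
  Series : Set c
  Series = ℕ → Carrier

  ι : ℕ → Carrier
  ι = natR cring

  sumTo : ℕ → (ℕ → Carrier) → Carrier
  sumTo zero    g = g zero
  sumTo (suc n) g = sumTo n g + g (suc n)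

  fact : ℕ → Carrier
  fact zero    = 1#
  fact (suc n) = ι (suc n) * fact n

  powK : Carrier → ℕ → Carrier
  powK x zero    = 1#
  powK x (suc k) = x * powK x k

  falling : Carrier → ℕ → Carrier
  falling x zero    = 1#
  falling x (suc k) = falling x k * (x - ι k)

  oneS : Series
  oneS zero    = 1#
  oneS (suc n) = 0#

  tS : Series
  tS zero          = 0#
  tS (suc zero)    = 1#
  tS (suc (suc n)) = 0#

  mulS : Series → Series → Series
  mulS a b n = sumTo n (λ i → a i * b (n ∸ i))

  powS : Series → ℕ → Series
  powS a zero    = oneS
  powS a (suc k) = mulS a (powS a k)

  -- composition g(h(t)), for h with h(0) = 0
  compS : Series → Series → Series
  compS g h n = sumTo n (λ k → g k * powS h k n)

  -- exp(g(t)) = Σ_k g^k / k!, for g with g(0) = 0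
  expS : Series → Series
  expS g n = sumTo n (λ k → (fact k ⁻¹) * powS g k n)

  _≈S_ : Series → Series → Set ℓ
  a ≈S b = ∀ n → a n ≈ b n

  IsDelta : Series → Set ℓ
  IsDelta f = (f 0 ≈ 0#) × ¬ (f 1 ≈ 0#)

  IsCompInverse : Series → Series → Set ℓ
  IsCompInverse f fbar =
    (fbar 0 ≈ 0#) × (compS f fbar ≈S tS) × (compS fbar f ≈S tS)

  pCoeff : Series → ℕ → Carrier
  pCoeff fbar n = fact n * expS fbar n

  -- u(t) with (e^{fbar(t)} - 1)/t = p_1 (1 + u(t))
  uS : Series → Series
  uS fbar n = (expS fbar (suc n) * (pCoeff fbar 1 ⁻¹)) - oneS n

  binomK : Carrier → ℕ → Carrier
  binomK x k = falling x k * (fact k ⁻¹)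

  -- (t/(e^{fbar(t)}-1))^α := p1^{-α} Σ_k binom(-α,k) u(t)^k ,
  -- where c stands for the fixed value of p1^{-α}
  -- (coefficient of t^n: only k ≤ n contribute, since u(0)=0)
  powAlphaS : Series → Carrier → Carrier → Series
  powAlphaS fbar α c n = c * sumTo n (λ k → binomK (- α) k * powS (uS fbar) k n)

  Bern : Series → Carrier → Carrier → ℕ → Carrier
  Bern fbar α c n = fact n * powAlphaS fbar α c n

  -- partial Bell polynomial B_{n,k}(x_1, x_2, ...), the sequence x indexed
  -- from 1 (x 0 is ignored): n! [t^n] (1/k!) (Σ_{m≥1} x_m t^m/m!)^k
  bellPartial : ℕ → ℕ → (ℕ → Carrier) → Carrier
  bellPartial n k x =
    fact n * ((fact k ⁻¹) * powS egf k n)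
    where
      egf : Series
      egf zero    = 0#
      egf (suc m) = x (suc m) * (fact (suc m) ⁻¹)

-- Since e^{f̄(t)} = 1 + p₁ t + Σ_{m≥1} p_{m+1} t^{m+1}/(m+1)!, dividing e^{f̄(t)} − 1 by t
-- gives p₁ (1 + u(t)) with u(t) = p₁⁻¹ E(t), where E(t) = Σ_{m≥1} (p_{m+1}/(m+1)) t^m/m!.
-- Hence u(t)^k = p₁^{-k} E(t)^k, and n! [t^n] E(t)^k / k! is by definition the partial
-- Bell polynomial B_{n,k}(p₂/2, p₃/3, …).  Substituting into the defining series
-- p₁^{-α} Σ_k binom(−α, k) u(t)^k and using binom(−α, k) = (−α)_k / k! gives the formula
-- term by term.  The only hypothesis needed is p₁ = f̄₁ ≠ 0, read off the t-coefficient of f ∘ f̄ = t.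
module Submission where

open import Defs
open import Data.Nat using (ℕ; zero; suc; _∸_)
open import Data.Product using (_,_)
open import Relation.Nullary using (¬_)
import Relation.Binary.Reasoning.Setoid as ≈-Reasoning
import Algebra.Solver.CommutativeMonoid as CommutativeMonoidSolver

module FieldProperties {c ℓ} (F : CharZeroField c ℓ) where
  open CharZeroField F hiding (zero)
  open FPS F
  open ≈-Reasoning setoid

  1≉0 : ¬ (1# ≈ 0#)
  1≉0 1≈0 = char0 0 (trans (+-identityʳ 1#) 1≈0)

  x⁻¹*x≈1 : ∀ x → ¬ (x ≈ 0#) → (x ⁻¹) * x ≈ 1#
  x⁻¹*x≈1 x x≉0 = trans (*-comm _ _) (⁻¹-inverse x x≉0)

  *-nonzero : ∀ {x y} → ¬ (x ≈ 0#) → ¬ (y ≈ 0#) → ¬ (x * y ≈ 0#)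
  *-nonzero {x} {y} x≉0 y≉0 xy≈0 = y≉0 (begin
    y                 ≈⟨ sym (*-identityˡ y) ⟩
    1# * y            ≈⟨ *-congʳ (sym (x⁻¹*x≈1 x x≉0)) ⟩
    ((x ⁻¹) * x) * y  ≈⟨ *-assoc _ _ _ ⟩
    (x ⁻¹) * (x * y)  ≈⟨ *-congˡ xy≈0 ⟩
    (x ⁻¹) * 0#       ≈⟨ zeroʳ _ ⟩
    0#                ∎)

  x≈1⇒x⁻¹≈1 : ∀ {x} → x ≈ 1# → x ⁻¹ ≈ 1#
  x≈1⇒x⁻¹≈1 {x} x≈1 = begin
    x ⁻¹       ≈⟨ sym (*-identityˡ _) ⟩
    1# * x ⁻¹  ≈⟨ *-congʳ (sym x≈1) ⟩
    x * x ⁻¹   ≈⟨ ⁻¹-inverse x (λ x≈0 → 1≉0 (trans (sym x≈1) x≈0)) ⟩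
    1#         ∎

  fact-nonzero : ∀ n → ¬ (fact n ≈ 0#)
  fact-nonzero zero    = 1≉0
  fact-nonzero (suc n) = *-nonzero (char0 n) (fact-nonzero n)

  fact-1 : fact 1 ≈ 1#
  fact-1 = trans (*-identityʳ _) (+-identityʳ 1#)

  fact-suc-cancel : ∀ n e → ((fact (suc n) * e) * (ι (suc n) ⁻¹)) * (fact n ⁻¹) ≈ e
  fact-suc-cancel n e = begin
    ((ι (suc n) * fact n * e) * (ι (suc n) ⁻¹)) * (fact n ⁻¹)
      ≈⟨ solve 5 (λ a b e a' b' → (((a ⊕ b) ⊕ e) ⊕ a') ⊕ b' ⊜ e ⊕ ((a ⊕ a') ⊕ (b ⊕ b'))) refl
               (ι (suc n)) (fact n) e (ι (suc n) ⁻¹) (fact n ⁻¹) ⟩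
    e * ((ι (suc n) * ι (suc n) ⁻¹) * (fact n * fact n ⁻¹))
      ≈⟨ *-congˡ (*-cong (⁻¹-inverse _ (char0 n)) (⁻¹-inverse _ (fact-nonzero n))) ⟩
    e * (1# * 1#)
      ≈⟨ trans (*-congˡ (*-identityˡ 1#)) (*-identityʳ e) ⟩
    e ∎
    where open CommutativeMonoidSolver *-commutativeMonoid using (solve; _⊜_; _⊕_)

module SeriesProperties {c ℓ} (F : CharZeroField c ℓ) where
  open CharZeroField F hiding (zero)
  open FPS F
  open FieldProperties F

  sumTo-cong : ∀ n {g h : ℕ → Carrier} → (∀ i → g i ≈ h i) → sumTo n g ≈ sumTo n h
  sumTo-cong zero    g≈h = g≈h zero
  sumTo-cong (suc n) g≈h = +-cong (sumTo-cong n g≈h) (g≈h (suc n))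

  *-distribˡ-sumTo : ∀ n x (g : ℕ → Carrier) → x * sumTo n g ≈ sumTo n (λ i → x * g i)
  *-distribˡ-sumTo zero    x g = refl
  *-distribˡ-sumTo (suc n) x g =
    trans (distribˡ x (sumTo n g) (g (suc n))) (+-congʳ (*-distribˡ-sumTo n x g))

  mulS-cong : ∀ {a a′ b b′} → a ≈S a′ → b ≈S b′ → mulS a b ≈S mulS a′ b′
  mulS-cong a≈a′ b≈b′ n = sumTo-cong n (λ i → *-cong (a≈a′ i) (b≈b′ (n ∸ i)))

  powS-cong : ∀ {a b} → a ≈S b → ∀ k → powS a k ≈S powS b k
  powS-cong a≈b zero    _ = refl
  powS-cong a≈b (suc k)   = mulS-cong a≈b (powS-cong a≈b k)

  scaleS : Carrier → Series → Series
  scaleS s a n = s * a n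

  mulS-scaleS : ∀ s r a b n → mulS (scaleS s a) (scaleS r b) n ≈ (s * r) * mulS a b n
  mulS-scaleS s r a b n = trans
    (sumTo-cong n (λ i → solve 4 (λ s a r b → (s ⊕ a) ⊕ (r ⊕ b) ⊜ (s ⊕ r) ⊕ (a ⊕ b)) refl
                                 s (a i) r (b (n ∸ i))))
    (sym (*-distribˡ-sumTo n (s * r) _))
    where open CommutativeMonoidSolver *-commutativeMonoid using (solve; _⊜_; _⊕_)

  powS-scaleS : ∀ s a k → powS (scaleS s a) k ≈S scaleS (powK s k) (powS a k)
  powS-scaleS s a zero    n = sym (*-identityˡ _)
  powS-scaleS s a (suc k) n =
    trans (mulS-cong (λ _ → refl) (powS-scaleS s a k) n) (mulS-scaleS s (powK s k) a (powS a k) n)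

  powS-1-coeff₁ : ∀ g → powS g 1 1 ≈ g 1
  powS-1-coeff₁ g = trans (+-cong (zeroʳ _) (*-identityʳ _)) (+-identityˡ _)

  compS-coeff₁ : ∀ f g → compS f g 1 ≈ f 1 * g 1
  compS-coeff₁ f g = trans (+-cong (zeroʳ _) (*-congˡ (powS-1-coeff₁ g))) (+-identityˡ _)

  expS-coeff₁ : ∀ g → expS g 1 ≈ g 1
  expS-coeff₁ g = begin
    (fact 0 ⁻¹ * 0#) + (fact 1 ⁻¹ * powS g 1 1)  ≈⟨ +-cong (zeroʳ _) (*-cong (x≈1⇒x⁻¹≈1 fact-1) (powS-1-coeff₁ g)) ⟩
    0# + (1# * g 1)                              ≈⟨ trans (+-identityˡ _) (*-identityˡ _) ⟩
    g 1                                          ∎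
    where open ≈-Reasoning setoid

  pCoeff-1 : ∀ g → pCoeff g 1 ≈ expS g 1
  pCoeff-1 g = trans (*-congʳ fact-1) (*-identityˡ _)

  rightInverse⇒coeff₁≉0 : ∀ {f g} → compS f g ≈S tS → ¬ (g 1 ≈ 0#)
  rightInverse⇒coeff₁≉0 {f} {g} f∘g≈t g₁≈0 =
    1≉0 (trans (sym (f∘g≈t 1)) (trans (compS-coeff₁ f g) (trans (*-congˡ g₁≈0) (zeroʳ _))))

  bellPartial-≈ : ∀ n k x e → e 0 ≈ 0# → (∀ m → x (suc m) * (fact (suc m) ⁻¹) ≈ e (suc m)) →
                  bellPartial n k x ≈ fact n * ((fact k ⁻¹) * powS e k n)
  bellPartial-≈ n k x e e₀≈0 x≈e =
    *-congˡ (*-congˡ (powS-cong (λ { zero → sym e₀≈0 ; (suc m) → x≈e m }) k n))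

module BernoulliBell {c ℓ} (F : CharZeroField c ℓ) (fbar : FPS.Series F) where
  open CharZeroField F hiding (zero)
  open FPS F
  open FieldProperties F
  open SeriesProperties F
  open ≈-Reasoning setoid

  p₁⁻¹ : Carrier
  p₁⁻¹ = pCoeff fbar 1 ⁻¹

  -- E(t) = Σ_{m≥1} (p_{m+1}/(m+1)) t^m/m!, the exponential generating function of the Bell arguments.
  tailS : Series
  tailS zero    = 0#
  tailS (suc m) = expS fbar (suc (suc m))

  uS≈p₁⁻¹*tailS : ¬ (pCoeff fbar 1 ≈ 0#) → uS fbar ≈S scaleS p₁⁻¹ tailS
  uS≈p₁⁻¹*tailS p₁≉0 zero = begin
    (expS fbar 1 * p₁⁻¹) - 1#  ≈⟨ +-congʳ (trans (*-congʳ (sym (pCoeff-1 fbar))) (⁻¹-inverse _ p₁≉0)) ⟩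
    1# - 1#                    ≈⟨ -‿inverseʳ 1# ⟩
    0#                         ≈⟨ sym (zeroʳ p₁⁻¹) ⟩
    p₁⁻¹ * 0#                  ∎
  uS≈p₁⁻¹*tailS p₁≉0 (suc m) = begin
    (expS fbar (suc (suc m)) * p₁⁻¹) - 0#  ≈⟨ +-congˡ (trans (sym (+-identityˡ _)) (-‿inverseʳ 0#)) ⟩
    (expS fbar (suc (suc m)) * p₁⁻¹) + 0#  ≈⟨ +-identityʳ _ ⟩
    expS fbar (suc (suc m)) * p₁⁻¹         ≈⟨ *-comm _ _ ⟩
    p₁⁻¹ * expS fbar (suc (suc m))         ∎

  bellPartial-tailS : ∀ n k →
    bellPartial n k (λ m → pCoeff fbar (suc m) * (ι (suc m) ⁻¹)) ≈ fact n * ((fact k ⁻¹) * powS tailS k n)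
  bellPartial-tailS n k = bellPartial-≈ n k _ tailS refl (λ m → fact-suc-cancel (suc m) _)

  Bern-term : ¬ (pCoeff fbar 1 ≈ 0#) → ∀ α c′ n k →
    fact n * (c′ * (binomK (- α) k * powS (uS fbar) k n))
      ≈ falling (- α) k * ((c′ * powK p₁⁻¹ k)
                          * bellPartial n k (λ m → pCoeff fbar (suc m) * (ι (suc m) ⁻¹)))
  Bern-term p₁≉0 α c′ n k = begin
    fact n * (c′ * ((falling (- α) k * (fact k ⁻¹)) * powS (uS fbar) k n))
      ≈⟨ *-congˡ (*-congˡ (*-congˡ
           (trans (powS-cong (uS≈p₁⁻¹*tailS p₁≉0) k n) (powS-scaleS p₁⁻¹ tailS k n)))) ⟩
    fact n * (c′ * ((falling (- α) k * (fact k ⁻¹)) * (powK p₁⁻¹ k * powS tailS k n)))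
      ≈⟨ solve 6 (λ n! c′ φ k!⁻¹ π σ → n! ⊕ (c′ ⊕ ((φ ⊕ k!⁻¹) ⊕ (π ⊕ σ)))
                                       ⊜ φ ⊕ ((c′ ⊕ π) ⊕ (n! ⊕ (k!⁻¹ ⊕ σ)))) refl
               (fact n) c′ (falling (- α) k) (fact k ⁻¹) (powK p₁⁻¹ k) (powS tailS k n) ⟩
    falling (- α) k * ((c′ * powK p₁⁻¹ k) * (fact n * ((fact k ⁻¹) * powS tailS k n)))
      ≈⟨ *-congˡ (*-congˡ (sym (bellPartial-tailS n k))) ⟩
    falling (- α) k * ((c′ * powK p₁⁻¹ k)
                      * bellPartial n k (λ m → pCoeff fbar (suc m) * (ι (suc m) ⁻¹))) ∎
    where open CommutativeMonoidSolver *-commutativeMonoid using (solve; _⊜_; _⊕_)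

lemma2p4 : ∀ {c ℓ} (F : CharZeroField c ℓ) →
  let open CharZeroField F
      open FPS F
  in (f fbar : Series) → IsDelta f → IsCompInverse f fbar →
     (α p1^-α : Carrier) → (n : ℕ) →
     Bern fbar α p1^-α n
       ≈ sumTo n (λ k → falling (- α) k
                        * ((p1^-α * powK (pCoeff fbar 1 ⁻¹) k)
                        * bellPartial n k (λ m → pCoeff fbar (suc m) * (ι (suc m) ⁻¹))))
lemma2p4 F f fbar _ (_ , f∘fbar≈t , _) α p1^-α n = begin
  fact n * (p1^-α * sumTo n (λ k → binomK (- α) k * powS (uS fbar) k n))
    ≈⟨ *-congˡ (*-distribˡ-sumTo n p1^-α _) ⟩
  fact n * sumTo n (λ k → p1^-α * (binomK (- α) k * powS (uS fbar) k n))
    ≈⟨ *-distribˡ-sumTo n (fact n) _ ⟩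
  sumTo n (λ k → fact n * (p1^-α * (binomK (- α) k * powS (uS fbar) k n)))
    ≈⟨ sumTo-cong n (Bern-term p₁≉0 α p1^-α n) ⟩
  sumTo n (λ k → falling (- α) k
                 * ((p1^-α * powK (pCoeff fbar 1 ⁻¹) k)
                 * bellPartial n k (λ m → pCoeff fbar (suc m) * (ι (suc m) ⁻¹)))) ∎
  where
  open CharZeroField F hiding (zero)
  open FPS F
  open SeriesProperties F
  open BernoulliBell F fbar
  open ≈-Reasoning setoid

  p₁≉0 : ¬ (pCoeff fbar 1 ≈ 0#)
  p₁≉0 p₁≈0 = rightInverse⇒coeff₁≉0 f∘fbar≈t
    (trans (sym (expS-coeff₁ fbar)) (trans (sym (pCoeff-1 fbar)) p₁≈0))
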